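{- Let $\Delta$ be a finite simplicial complex with vertex set $V$ and $\kappa\colon V\to[k]$ a $k$-linear coloring of $\Delta$. Then for each $i\in[k]$ there exists a facet $F$ of $\Delta$ containing every vertex $v\in V$ with $\kappa(v)=i$. Moreover, for each $i\in[k]$ there exists a vertex $v\in V$ lying on every facet of $\Delta$ that contains at least one vertex of color $i$.
   Context: $[k]=\{1,\dots,k\}$; facets are maximal faces. For a face $S$, $S_\kappa(t)=|\{v\in S:\kappa(v)=t\}|$ defines a multiset on $[k]$; $\|M\|=\sum_tM(t)$, $(M\cap M')(t)=\min(M(t),M'(t))$. A $k$-linear coloring is a surjective $\kappa\colon V\to[k]$ with $\|F_\kappa\cap F'_\kappa\|=|F\cap F'|$ for all facets $F,F'$. -}

module Defs where

open import Data.Nat using (ℕ; _⊓_)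
open import Data.Fin using (Fin; _≟_)
open import Data.Fin.Subset using (Subset; _∈_; _⊆_; ⁅_⁆; _∩_; ∣_∣)
open import Data.Vec using (sum; tabulate)
open import Data.Product using (Σ; ∃; _×_)
open import Relation.Nullary using (Dec; ¬_)
open import Relation.Nullary.Decidable using (⌊_⌋)
open import Relation.Binary.PropositionalEquality using (_≡_)

-- A finite simplicial complex on vertex set V = Fin n, given by its
-- (decidable) face predicate: faces are closed under subsets and every
-- vertex {v} is a face (so the vertex set is exactly Fin n).
record SimplicialComplex (n : ℕ) : Set₁ where
  field
    IsFace     : Subset n → Set
    isFace?    : (F : Subset n) → Dec (IsFace F)
    downClosed : ∀ {F G} → IsFace F → G ⊆ F → IsFace G
    vertices   : ∀ v → IsFace ⁅ v ⁆
open SimplicialComplex public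

IsFacet : ∀ {n} → SimplicialComplex n → Subset n → Set
IsFacet Δ F = IsFace Δ F × (∀ G → IsFace Δ G → F ⊆ G → G ≡ F)

colorClass : ∀ {n k} → (Fin n → Fin k) → Fin k → Subset n
colorClass κ t = tabulate (λ v → ⌊ κ v ≟ t ⌋)

colorMultiset : ∀ {n k} → (Fin n → Fin k) → Subset n → Fin k → ℕ
colorMultiset κ F t = ∣ F ∩ colorClass κ t ∣

multisetMeetSize : ∀ {k} → (Fin k → ℕ) → (Fin k → ℕ) → ℕ
multisetMeetSize M M' = sum (tabulate (λ t → M t ⊓ M' t))

Surjective : ∀ {n k} → (Fin n → Fin k) → Set
Surjective {n} κ = ∀ t → ∃ λ (v : Fin n) → κ v ≡ t

IsLinearColoring : ∀ {n k} → SimplicialComplex n → (Fin n → Fin k) → Set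
IsLinearColoring Δ κ =
  Surjective κ ×
  (∀ F F' → IsFacet Δ F → IsFacet Δ F' →
     multisetMeetSize (colorMultiset κ F) (colorMultiset κ F') ≡ ∣ F ∩ F' ∣)

-- Within a colour class, the facets of a linearly coloured complex are totally ordered by
-- inclusion: counting |F ∩ G| colour by colour, linearity forces |F_i ∩ G_i| = min (|F_i|, |G_i|),
-- whence F_i ⊆ G_i or G_i ⊆ F_i. Every vertex lies on some facet, so a facet with ⊆-maximal
-- colour-i part contains the whole colour class i; dually, a colour-i vertex of a facet whose
-- colour-i part is ⊆-minimal among the facets meeting colour i lies on all of them. Such extremal
-- facets exist since there are finitely many subsets and facethood is decidable.
module Submission where

open import Defs
open import Data.Nat using (ℕ)
open import Data.Fin using (Fin)
open import Data.Fin.Subset using (Subset; _∈_)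
open import Data.Product using (Σ; ∃; _×_)
open import Relation.Binary.PropositionalEquality using (_≡_)

import Algebra.Properties.IdempotentCommutativeMonoid as IdempotentCommutativeMonoidProperties
open import Data.Bool using (true; false)
open import Data.Fin using (zero; suc)
open import Data.Fin.Properties using (_≟_; any?)
open import Data.Fin.Subset using (_⊆_; _⊂_; _⊃_; _∩_; ∣_∣)
open import Data.Fin.Subset.Induction using (⊂-wellFounded; ⊃-wellFounded)
open import Data.Fin.Subset.Properties
  using (_∈?_; _⊆?_; _⊂?_; ⊆-antisym; ⊆-trans; p∩q⊆p; x∈p∩q⁺; x∈p∩q⁻; x∈⁅x⁆; ∩-comm;
         ∣p∩q∣≤∣p∣⊓∣q∣; p⊂q⇒∣p∣<∣q∣; anySubset?; ∩-idempotentCommutativeMonoid)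
open import Data.Nat using (zero; suc; _+_; _≤_; _⊓_; z≤n)
open import Data.Nat.Properties
  using (+-suc; +-mono-≤; +-monoʳ-≤; +-cancelʳ-≤; +-cancelˡ-≡; ≤-antisym; <-irrefl; ⊓-sel)
open import Data.Product using (_,_; proj₁; proj₂)
open import Data.Sum using (_⊎_; inj₁; inj₂)
open import Data.Vec using (_∷_; []; sum; tabulate)
open import Data.Vec.Properties using (tabulate-cong; lookup⇒[]=; lookup∘tabulate)
open import Function using (_∘_; id; flip)
open import Induction.WellFounded using (WellFounded; Acc; acc)
open import Relation.Binary using (Rel; Decidable)
import Relation.Binary.Construct.On as On
open import Relation.Binary.PropositionalEquality using (refl; sym; trans; cong; subst; module ≡-Reasoning)
open import Relation.Nullary using (¬_; yes; no)
open import Relation.Nullary.Decidable using (⌊_⌋; map′; ¬?; _×-dec_; decidable-stable; dec-true; isYes≗does; ⌊⌋-map′)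
open import Relation.Unary using (Pred)
import Relation.Unary as U

sum-tabulate-0 : ∀ k → sum (tabulate {n = k} (λ _ → 0)) ≡ 0
sum-tabulate-0 zero    = refl
sum-tabulate-0 (suc k) = sum-tabulate-0 k

sum-tabulate-mono-≤ : ∀ {k} {f g : Fin k → ℕ} → (∀ t → f t ≤ g t) →
  sum (tabulate f) ≤ sum (tabulate g)
sum-tabulate-mono-≤ {zero}  f≤g = z≤n
sum-tabulate-mono-≤ {suc k} f≤g = +-mono-≤ (f≤g zero) (sum-tabulate-mono-≤ (f≤g ∘ suc))

+-≤-≡⇒≡ : ∀ {a b c d} → a ≤ b → c ≤ d → a + c ≡ b + d → a ≡ b × c ≡ d
+-≤-≡⇒≡ {a} {b} {c} {d} a≤b c≤d eq = a≡b , +-cancelˡ-≡ a c d (trans eq (cong (_+ d) (sym a≡b)))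
  where
  b+d≤a+d : b + d ≤ a + d
  b+d≤a+d = subst (_≤ a + d) eq (+-monoʳ-≤ a c≤d)
  a≡b : a ≡ b
  a≡b = ≤-antisym a≤b (+-cancelʳ-≤ d b a b+d≤a+d)

sum-tabulate-≤-≡⇒≡ : ∀ {k} {f g : Fin k → ℕ} → (∀ t → f t ≤ g t) →
  sum (tabulate f) ≡ sum (tabulate g) → ∀ t → f t ≡ g t
sum-tabulate-≤-≡⇒≡ {suc k} f≤g eq zero    =
  proj₁ (+-≤-≡⇒≡ (f≤g zero) (sum-tabulate-mono-≤ (f≤g ∘ suc)) eq)
sum-tabulate-≤-≡⇒≡ {suc k} f≤g eq (suc t) =
  sum-tabulate-≤-≡⇒≡ (f≤g ∘ suc) (proj₂ (+-≤-≡⇒≡ (f≤g zero) (sum-tabulate-mono-≤ (f≤g ∘ suc)) eq)) t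

∩-distribʳ-∩ : ∀ {n} (p q r : Subset n) → (p ∩ q) ∩ r ≡ (p ∩ r) ∩ (q ∩ r)
∩-distribʳ-∩ {n} p q r = ∙-distrʳ-∙ r p q
  where open IdempotentCommutativeMonoidProperties (∩-idempotentCommutativeMonoid n)

∣p∩q∣≡∣p∣⇒p⊆q : ∀ {n} {p q : Subset n} → ∣ p ∩ q ∣ ≡ ∣ p ∣ → p ⊆ q
∣p∩q∣≡∣p∣⇒p⊆q {p = p} {q} eq {x} x∈p = decidable-stable (x ∈? q) λ x∉q →
  <-irrefl eq (p⊂q⇒∣p∣<∣q∣ (p∩q⊆p p q , x , x∈p , x∉q ∘ proj₂ ∘ x∈p∩q⁻ p q))

∣p∩q∣≡∣p∣⊓∣q∣⇒p⊆q⊎q⊆p : ∀ {n} {p q : Subset n} → ∣ p ∩ q ∣ ≡ ∣ p ∣ ⊓ ∣ q ∣ → p ⊆ q ⊎ q ⊆ p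
∣p∩q∣≡∣p∣⊓∣q∣⇒p⊆q⊎q⊆p {p = p} {q} eq with ⊓-sel ∣ p ∣ ∣ q ∣
... | inj₁ ⊓≡∣p∣ = inj₁ (∣p∩q∣≡∣p∣⇒p⊆q (trans eq ⊓≡∣p∣))
... | inj₂ ⊓≡∣q∣ = inj₂ (∣p∩q∣≡∣p∣⇒p⊆q (trans (cong ∣_∣ (∩-comm q p)) (trans eq ⊓≡∣q∣)))

¬q⊂p⇒p⊆q : ∀ {n} {p q : Subset n} → p ⊆ q ⊎ q ⊆ p → ¬ q ⊂ p → p ⊆ q
¬q⊂p⇒p⊆q (inj₁ p⊆q) _ = p⊆q
¬q⊂p⇒p⊆q {q = q} (inj₂ q⊆p) q⊄p {x} x∈p =
  decidable-stable (x ∈? q) λ x∉q → q⊄p (q⊆p , x , x∈p , x∉q)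

∃-minimal : ∀ {n ℓ r} {P : Pred (Subset n) ℓ} {_<_ : Rel (Subset n) r} →
  WellFounded _<_ → Decidable _<_ → U.Decidable P → ∀ {A} → P A →
  ∃ λ B → P B × ∀ C → P C → ¬ C < B
∃-minimal {P = P} {_<_} wf _<?_ P? {A} = go (wf A)
  where
  go : ∀ {A} → Acc _<_ A → P A → ∃ λ B → P B × ∀ C → P C → ¬ C < B
  go {A} (acc rs) pA with anySubset? (λ C → P? C ×-dec C <? A)
  ... | yes (C , pC , C<A) = go (rs C<A) pC
  ... | no  ∄C             = A , pA , λ C pC C<A → ∄C (C , pC , C<A)

colorPart : ∀ {n k} → (Fin n → Fin k) → Fin k → Subset n → Subset n
colorPart κ i X = X ∩ colorClass κ i

κ≡⇒∈colorClass : ∀ {n k} (κ : Fin n → Fin k) {i v} → κ v ≡ i → v ∈ colorClass κ i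
κ≡⇒∈colorClass κ {i} {v} κv≡i = lookup⇒[]= v (colorClass κ i)
  (trans (lookup∘tabulate _ v) (trans (isYes≗does (κ v ≟ i)) (dec-true (κ v ≟ i) κv≡i)))

sum-∣≟∷∣ : ∀ {k n} (c : Fin k) (Y : Fin k → Subset n) →
  sum (tabulate (λ t → ∣ ⌊ c ≟ t ⌋ ∷ Y t ∣)) ≡ suc (sum (tabulate (λ t → ∣ Y t ∣)))
sum-∣≟∷∣ zero    Y = refl
sum-∣≟∷∣ (suc c) Y = begin
  ∣ Y zero ∣ + sum (tabulate (λ t → ∣ ⌊ suc c ≟ suc t ⌋ ∷ Y (suc t) ∣))
    ≡⟨ cong (λ s → ∣ Y zero ∣ + sum s) (tabulate-cong λ t →
         cong (λ b → ∣ b ∷ Y (suc t) ∣) (⌊⌋-map′ _ _ (c ≟ t))) ⟩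
  ∣ Y zero ∣ + sum (tabulate (λ t → ∣ ⌊ c ≟ t ⌋ ∷ Y (suc t) ∣))
    ≡⟨ cong (∣ Y zero ∣ +_) (sum-∣≟∷∣ c (Y ∘ suc)) ⟩
  ∣ Y zero ∣ + suc (sum (tabulate (λ t → ∣ Y (suc t) ∣)))
    ≡⟨ +-suc ∣ Y zero ∣ _ ⟩
  suc (sum (tabulate (λ t → ∣ Y t ∣)))  ∎
  where open ≡-Reasoning

sum-∣∩colorClass∣ : ∀ {n k} (κ : Fin n → Fin k) (X : Subset n) →
  sum (tabulate (λ t → ∣ X ∩ colorClass κ t ∣)) ≡ ∣ X ∣
sum-∣∩colorClass∣ {k = k} κ []  = sum-tabulate-0 k
sum-∣∩colorClass∣ κ (false ∷ X) = sum-∣∩colorClass∣ (κ ∘ suc) X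
sum-∣∩colorClass∣ κ (true ∷ X)  =
  trans (sum-∣≟∷∣ (κ zero) (λ t → X ∩ colorClass (κ ∘ suc) t))
        (cong suc (sum-∣∩colorClass∣ (κ ∘ suc) X))

module _ {n} (Δ : SimplicialComplex n) where

  maximal⇒IsFacet : ∀ {F} → IsFace Δ F → (∀ G → IsFace Δ G → ¬ F ⊂ G) → IsFacet Δ F
  maximal⇒IsFacet fF maximal =
    fF , λ G fG F⊆G → ⊆-antisym (¬q⊂p⇒p⊆q (inj₂ F⊆G) (maximal G fG)) F⊆G

  IsFacet⇒maximal : ∀ {F G} → IsFacet Δ F → IsFace Δ G → ¬ F ⊂ G
  IsFacet⇒maximal (_ , maximal) fG (F⊆G , x , x∈G , x∉F) =
    x∉F (subst (x ∈_) (maximal _ fG F⊆G) x∈G)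

  isFacet? : U.Decidable (IsFacet Δ)
  isFacet? F = map′
    (λ (fF , ∄G) → maximal⇒IsFacet fF λ G fG F⊂G → ∄G (G , fG , F⊂G))
    (λ facet → proj₁ facet , λ (G , fG , F⊂G) → IsFacet⇒maximal facet fG F⊂G)
    (isFace? Δ F ×-dec ¬? (anySubset? λ G → isFace? Δ G ×-dec F ⊂? G))

  face⊆facet : ∀ {G} → IsFace Δ G → ∃ λ F → IsFacet Δ F × G ⊆ F
  face⊆facet {G} fG
    with ∃-minimal ⊃-wellFounded (flip _⊂?_) (λ H → isFace? Δ H ×-dec G ⊆? H) (fG , id)
  ... | F , (fF , G⊆F) , maximal =
    F , maximal⇒IsFacet fF (λ H fH F⊂H → maximal H (fH , ⊆-trans G⊆F (proj₁ F⊂H)) F⊂H) , G⊆F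

module _ {n k} {Δ : SimplicialComplex n} {κ : Fin n → Fin k} (linear : IsLinearColoring Δ κ) where

  colorParts-comparable : ∀ {F G} → IsFacet Δ F → IsFacet Δ G → ∀ i →
    colorPart κ i F ⊆ colorPart κ i G ⊎ colorPart κ i G ⊆ colorPart κ i F
  -- Summing |F_t ∩ G_t| ≤ min (|F_t|, |G_t|) over all colours t gives |F ∩ G| on the left and,
  -- by linearity, also on the right; so each inequality is an equality.
  colorParts-comparable {F} {G} fF fG i =
    ∣p∩q∣≡∣p∣⊓∣q∣⇒p⊆q⊎q⊆p (sum-tabulate-≤-≡⇒≡ (λ t → ∣p∩q∣≤∣p∣⊓∣q∣ (part F t) (part G t)) sums i)
    where
    open ≡-Reasoning
    part : Subset n → Fin k → Subset n
    part X t = colorPart κ t X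
    sums : sum (tabulate λ t → ∣ part F t ∩ part G t ∣) ≡ sum (tabulate λ t → ∣ part F t ∣ ⊓ ∣ part G t ∣)
    sums = begin
      sum (tabulate λ t → ∣ part F t ∩ part G t ∣)
        ≡⟨ cong sum (tabulate-cong λ t → cong ∣_∣ (∩-distribʳ-∩ F G (colorClass κ t))) ⟨
      sum (tabulate λ t → ∣ part (F ∩ G) t ∣)  ≡⟨ sum-∣∩colorClass∣ κ (F ∩ G) ⟩
      ∣ F ∩ G ∣                                 ≡⟨ proj₂ linear F G fF fG ⟨
      multisetMeetSize (colorMultiset κ F) (colorMultiset κ G)  ∎

  colorPart-⊆⇒∈ : ∀ {F G i v} → colorPart κ i F ⊆ colorPart κ i G →
    v ∈ F → κ v ≡ i → v ∈ G
  colorPart-⊆⇒∈ {G = G} {i} F⊆G v∈F κv≡i =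
    proj₁ (x∈p∩q⁻ G (colorClass κ i) (F⊆G (x∈p∩q⁺ (v∈F , κ≡⇒∈colorClass κ κv≡i))))

  facet-⊇-colorClass : ∀ i → ∃ λ F → IsFacet Δ F × (∀ v → κ v ≡ i → v ∈ F)
  facet-⊇-colorClass i =
    let (v₀ , _)            = proj₁ linear i
        (_ , fF₀ , _)       = face⊆facet Δ (vertices Δ v₀)
        (F , fF , maximal)  = ∃-minimal (On.wellFounded (colorPart κ i) ⊃-wellFounded)
                                (On.decidable (colorPart κ i) _⊃_ (flip _⊂?_)) (isFacet? Δ) fF₀
    in F , fF , λ v κv≡i →
         let (G , fG , v∈G) = face⊆facet Δ (vertices Δ v)
         in colorPart-⊆⇒∈ (¬q⊂p⇒p⊆q (colorParts-comparable fG fF i) (maximal G fG))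
              (v∈G (x∈⁅x⁆ v)) κv≡i

  vertex-∈-facets-meeting-colorClass : ∀ i → ∃ λ v →
    ∀ F → IsFacet Δ F → (∃ λ w → w ∈ F × κ w ≡ i) → v ∈ F
  vertex-∈-facets-meeting-colorClass i =
    let (v₀ , κv₀≡i)        = proj₁ linear i
        (_ , fF₀ , v₀∈F₀)   = face⊆facet Δ (vertices Δ v₀)
        (F , (fF , w , w∈F , κw≡i) , minimal) =
          ∃-minimal (On.wellFounded (colorPart κ i) ⊂-wellFounded)
            (On.decidable (colorPart κ i) _⊂_ _⊂?_)
            (λ G → isFacet? Δ G ×-dec meets? G) (fF₀ , v₀ , v₀∈F₀ (x∈⁅x⁆ v₀) , κv₀≡i)
    in w , λ G fG meetsG →
         colorPart-⊆⇒∈ (¬q⊂p⇒p⊆q (colorParts-comparable fF fG i) (minimal G (fG , meetsG))) w∈F κw≡i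
    where
    meets? : U.Decidable (λ G → ∃ λ w → w ∈ G × κ w ≡ i)
    meets? G = any? λ w → w ∈? G ×-dec κ w ≟ i

proposition2p9 : ∀ {n k} (Δ : SimplicialComplex n) (κ : Fin n → Fin k) →
    IsLinearColoring Δ κ →
    (∀ (i : Fin k) → ∃ λ (F : Subset n) → IsFacet Δ F × (∀ v → κ v ≡ i → v ∈ F))
    × (∀ (i : Fin k) → ∃ λ (v : Fin n) →
         ∀ (F : Subset n) → IsFacet Δ F → (∃ λ w → w ∈ F × κ w ≡ i) → v ∈ F)
proposition2p9 Δ κ linear =
  facet-⊇-colorClass {Δ = Δ} {κ} linear , vertex-∈-facets-meeting-colorClass {Δ = Δ} {κ} linear
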